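{- $\mathbf{MIL}\subseteq\mathbf{MIN}$: every formula of $\mathcal{L}$ valid on all posets under the supremum semantics is valid on all posets under the minimal-upper-bound semantics.
   Context: The language $\mathcal{L}$ is given by $\varphi::=\bot\mid p\mid\neg\varphi\mid\varphi\lor\varphi\mid\Diamond\varphi\varphi$, with $p$ ranging over propositional letters and $\Diamond$ a binary modality. A poset model is $(P,\leq,V)$ with $(P,\leq)$ a partial order and $V$ a valuation. For $s,t,u\in P$: $s\in\mathrm{mub}\{t,u\}$ iff $s$ is an upper bound of $\{t,u\}$ and no upper bound $x$ of $\{t,u\}$ satisfies $x<s$; $s=\sup\{t,u\}$ iff $s$ is an upper bound of $\{t,u\}$ below every upper bound of $\{t,u\}$. Booleans are classical. Minimal-upper-bound semantics: $s\Vdash_M\Diamond\varphi\psi$ iff there are $t,u$ with $t\Vdash_M\varphi$, $u\Vdash_M\psi$, $s\in\mathrm{mub}\{t,u\}$. Supremum semantics: $s\Vdash_S\Diamond\varphi\psi$ iff there are $t,u$ with $t\Vdash_S\varphi$, $u\Vdash_S\psi$, $s=\sup\{t,u\}$. $\mathbf{MIN}$ (resp. $\mathbf{MIL}$) is the set of formulas valid (true at every point under every valuation) on every poset under $\Vdash_M$ (resp. $\Vdash_S$). -}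

module Defs where

open import Data.Nat using (ℕ)
open import Data.Product using (Σ; _×_; ∃-syntax)
open import Data.Sum using (_⊎_)
open import Data.Empty using (⊥)
open import Relation.Nullary using (¬_)
open import Relation.Binary.PropositionalEquality using (_≡_)
open import Relation.Binary.Structures using (IsPartialOrder)

data Form : Set where
  bot : Form
  var : ℕ → Form
  neg : Form → Form
  or  : Form → Form → Form
  dia : Form → Form → Form

record PosetFrame : Set₁ where
  field
    Carrier : Set
    _≤_     : Carrier → Carrier → Set
    isPO    : IsPartialOrder _≡_ _≤_

module _ (F : PosetFrame) where
  open PosetFrame F

  _<_ : Carrier → Carrier → Set
  x < y = (x ≤ y) × ¬ (x ≡ y)

  IsUB : Carrier → Carrier → Carrier → Set
  IsUB s t u = (t ≤ s) × (u ≤ s)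

  IsMub : Carrier → Carrier → Carrier → Set
  IsMub s t u = IsUB s t u × (∀ x → IsUB x t u → ¬ (x < s))

  IsSup : Carrier → Carrier → Carrier → Set
  IsSup s t u = IsUB s t u × (∀ x → IsUB x t u → s ≤ x)

  Valuation : Set₁
  Valuation = ℕ → Carrier → Set

  -- Classical (Booleans are classical) semantics rendered via the
  -- Goedel-Gentzen negative translation: disjunction and existentials are
  -- double-negated, so every forcing statement is ¬¬-stable and classically
  -- equivalent to the usual clause.

  forcesM : Valuation → Carrier → Form → Set
  forcesM V s bot = ⊥
  forcesM V s (var p) = ¬ ¬ V p s
  forcesM V s (neg φ) = ¬ forcesM V s φ
  forcesM V s (or φ ψ) = ¬ (¬ forcesM V s φ × ¬ forcesM V s ψ)
  forcesM V s (dia φ ψ) =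
    ¬ ¬ (∃[ t ] ∃[ u ] (forcesM V t φ × forcesM V u ψ × IsMub s t u))

  forcesS : Valuation → Carrier → Form → Set
  forcesS V s bot = ⊥
  forcesS V s (var p) = ¬ ¬ V p s
  forcesS V s (neg φ) = ¬ forcesS V s φ
  forcesS V s (or φ ψ) = ¬ (¬ forcesS V s φ × ¬ forcesS V s ψ)
  forcesS V s (dia φ ψ) =
    ¬ ¬ (∃[ t ] ∃[ u ] (forcesS V t φ × forcesS V u ψ × IsSup s t u))

InMIN : Form → Set₁
InMIN φ = (F : PosetFrame) (V : Valuation F) (s : PosetFrame.Carrier F) → forcesM F V s φ

InMIL : Form → Set₁
InMIL φ = (F : PosetFrame) (V : Valuation F) (s : PosetFrame.Carrier F) → forcesS F V s φ

-- Unravel a poset F into a tree of mub-decompositions: a node labelled s has,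
-- for every s ∈ mub{t,u}, a left child labelled t and a right child labelled u,
-- and in the tree order the node is the supremum of these two children.  To
-- keep every other pair of nodes from acquiring a supremum, put above each
-- non-sibling pair a fresh point lying exactly above the descendants of the
-- pair.  A node is then the supremum of two points only if they are its
-- children or it is one of them; in both cases its label is a mub of theirs.
-- Hence a node forces φ under the supremum semantics iff its label forces φ
-- under the mub semantics, and validity transfers from MIL to MIN.
module Submission where

open import Defs
import Data.Nat as ℕ
import Data.Nat.Properties as ℕₚ
open import Data.Product using (Σ; _×_; _,_; proj₁; ∃-syntax)
open import Data.Product.Function.NonDependent.Propositional using (_×-⇔_)
open import Data.Sum using (_⊎_; inj₁; inj₂)
open import Data.Empty using (⊥; ⊥-elim)
open import Function.Bundles using (_⇔_; mk⇔; Equivalence)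
open import Function.Construct.Identity using (⇔-id)
open import Function.Related.TypeIsomorphisms using (¬-cong-⇔)
open import Relation.Nullary using (¬_; Dec; yes; no)
open import Relation.Nullary.Decidable using (¬¬-excluded-middle)
open import Relation.Nullary.Negation using (¬¬-map)
open import Relation.Binary.PropositionalEquality
  using (_≡_; refl; sym; cong; subst; isEquivalence)
open import Relation.Binary.Structures using (IsPartialOrder)

open Equivalence using (to; from)

module _ (F : PosetFrame) where
  open PosetFrame F
  open IsPartialOrder isPO using (antisym)

  IsUB-sym : ∀ {s t u} → IsUB F s t u → IsUB F s u t
  IsUB-sym (t≤s , u≤s) = u≤s , t≤s

  IsSup-sym : ∀ {s t u} → IsSup F s t u → IsSup F s u t
  IsSup-sym (ub , least) = IsUB-sym ub , λ x ubx → least x (IsUB-sym ubx)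

  IsSup-unique : ∀ {s s′ t u} → IsSup F s t u → IsSup F s′ t u → s ≡ s′
  IsSup-unique (ub , least) (ub′ , least′) = antisym (least _ ub′) (least′ _ ub)

  IsMub-sym : ∀ {s t u} → IsMub F s t u → IsMub F s u t
  IsMub-sym (ub , minimal) = IsUB-sym ub , λ x ubx → minimal x (IsUB-sym ubx)

  IsMub-stable : ∀ {s t u} → IsUB F s t u → ¬ ¬ IsMub F s t u → IsMub F s t u
  IsMub-stable ub ¬¬mub =
    ub , λ x ubx x<s → ¬¬mub λ (_ , minimal) → minimal x ubx x<s

  IsUB-member⇒IsMub : ∀ {s t u} → IsUB F s t u → s ≡ t ⊎ s ≡ u → IsMub F s t u
  IsUB-member⇒IsMub ub s∈ =
    ub , λ { x ubx (x≤s , x≢s) → x≢s (antisym x≤s (≤-ub ubx s∈)) }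
    where
    ≤-ub : ∀ {s t u x} → IsUB F x t u → s ≡ t ⊎ s ≡ u → s ≤ x
    ≤-ub (t≤x , _) (inj₁ refl) = t≤x
    ≤-ub (_ , u≤x) (inj₂ refl) = u≤x

module Unravelling (F : PosetFrame) where
  open PosetFrame F renaming (Carrier to A)
  open IsPartialOrder isPO using () renaming (refl to ≤-refl; trans to ≤-trans)

  data Node : A → Set where
    root  : (s : A) → Node s
    left  : ∀ {s} → Node s → (t u : A) → IsMub F s t u → Node t
    right : ∀ {s} → Node s → (t u : A) → IsMub F s t u → Node u

  depth : ∀ {s} → Node s → ℕ.ℕ
  depth (root _)        = 0
  depth (left n _ _ _)  = ℕ.suc (depth n)
  depth (right n _ _ _) = ℕ.suc (depth n)

  data _≼_ : ∀ {a b} → Node a → Node b → Set where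
    ≼-refl  : ∀ {a} {x : Node a} → x ≼ x
    left-≼  : ∀ {s b t u m} {n : Node s} {y : Node b} → n ≼ y → left n t u m ≼ y
    right-≼ : ∀ {s b t u m} {n : Node s} {y : Node b} → n ≼ y → right n t u m ≼ y

  ≼-trans : ∀ {a b c} {x : Node a} {y : Node b} {z : Node c} → x ≼ y → y ≼ z → x ≼ z
  ≼-trans ≼-refl      y≼z = y≼z
  ≼-trans (left-≼ p)  y≼z = left-≼ (≼-trans p y≼z)
  ≼-trans (right-≼ p) y≼z = right-≼ (≼-trans p y≼z)

  ≼⇒depth-≥ : ∀ {a b} {x : Node a} {y : Node b} → x ≼ y → depth y ℕ.≤ depth x
  ≼⇒depth-≥ ≼-refl      = ℕₚ.≤-refl
  ≼⇒depth-≥ (left-≼ p)  = ℕₚ.m≤n⇒m≤1+n (≼⇒depth-≥ p)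
  ≼⇒depth-≥ (right-≼ p) = ℕₚ.m≤n⇒m≤1+n (≼⇒depth-≥ p)

  ≼-antisym : ∀ {a b} {x : Node a} {y : Node b} → x ≼ y → y ≼ x →
              _≡_ {A = Σ A Node} (a , x) (b , y)
  ≼-antisym ≼-refl      _   = refl
  ≼-antisym (left-≼ p)  y≼x =
    ⊥-elim (ℕₚ.1+n≰n (ℕₚ.≤-trans (≼⇒depth-≥ y≼x) (≼⇒depth-≥ p)))
  ≼-antisym (right-≼ p) y≼x =
    ⊥-elim (ℕₚ.1+n≰n (ℕₚ.≤-trans (≼⇒depth-≥ y≼x) (≼⇒depth-≥ p)))

  ≼⇒≤ : ∀ {a b} {x : Node a} {y : Node b} → x ≼ y → a ≤ b
  ≼⇒≤ ≼-refl                          = ≤-refl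
  ≼⇒≤ (left-≼ {m = (t≤s , _) , _} p)  = ≤-trans t≤s (≼⇒≤ p)
  ≼⇒≤ (right-≼ {m = (_ , u≤s) , _} p) = ≤-trans u≤s (≼⇒≤ p)

  children-≼⇒≼ : ∀ {s t u b m} {n : Node s} {y : Node b} →
                 left n t u m ≼ y → right n t u m ≼ y → n ≼ y
  children-≼⇒≼ (left-≼ p) _           = p
  children-≼⇒≼ ≼-refl     (right-≼ q) = q

  data Siblings : ∀ {a b} → Node a → Node b → Set where
    left-right : ∀ {s t u m} {n : Node s} → Siblings (left n t u m) (right n t u m)
    right-left : ∀ {s t u m} {n : Node s} → Siblings (right n t u m) (left n t u m)

  data Point : Set where
    node : ∀ {s} → Node s → Point
    cap  : ∀ {a b} (x : Node a) (y : Node b) → ¬ Siblings x y → Point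

  data _⊑_ : Point → Point → Set where
    node⊑node : ∀ {a b} {x : Node a} {y : Node b} → x ≼ y → node x ⊑ node y
    node⊑capˡ : ∀ {a b c} {x : Node a} {y : Node b} {z : Node c} {ns} →
                x ≼ y → node x ⊑ cap y z ns
    node⊑capʳ : ∀ {a b c} {x : Node a} {y : Node b} {z : Node c} {ns} →
                x ≼ z → node x ⊑ cap y z ns
    cap⊑cap   : ∀ {b c} {y : Node b} {z : Node c} {ns} → cap y z ns ⊑ cap y z ns

  ⊑-refl : ∀ {p} → p ⊑ p
  ⊑-refl {node _}    = node⊑node ≼-refl
  ⊑-refl {cap _ _ _} = cap⊑cap

  ⊑-trans : ∀ {p q r} → p ⊑ q → q ⊑ r → p ⊑ r
  ⊑-trans (node⊑node p) (node⊑node q) = node⊑node (≼-trans p q)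
  ⊑-trans (node⊑node p) (node⊑capˡ q) = node⊑capˡ (≼-trans p q)
  ⊑-trans (node⊑node p) (node⊑capʳ q) = node⊑capʳ (≼-trans p q)
  ⊑-trans (node⊑capˡ p) cap⊑cap       = node⊑capˡ p
  ⊑-trans (node⊑capʳ p) cap⊑cap       = node⊑capʳ p
  ⊑-trans cap⊑cap       cap⊑cap       = cap⊑cap

  node-injective : ∀ {a b} {x : Node a} {y : Node b} →
                   node x ≡ node y → _≡_ {A = Σ A Node} (a , x) (b , y)
  node-injective refl = refl

  ⊑-antisym : ∀ {p q} → p ⊑ q → q ⊑ p → p ≡ q
  ⊑-antisym (node⊑node p) (node⊑node q) = cong (λ (_ , x) → node x) (≼-antisym p q)
  ⊑-antisym cap⊑cap       cap⊑cap       = refl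

  unravelling : PosetFrame
  unravelling = record
    { Carrier = Point
    ; _≤_     = _⊑_
    ; isPO    = record
      { isPreorder = record
        { isEquivalence = isEquivalence
        ; reflexive     = λ { refl → ⊑-refl }
        ; trans         = ⊑-trans
        }
      ; antisym = ⊑-antisym
      }
    }

  children-sup : ∀ {s t u m} (n : Node s) →
                 IsSup unravelling (node n) (node (left n t u m)) (node (right n t u m))
  children-sup n = (node⊑node (left-≼ ≼-refl) , node⊑node (right-≼ ≼-refl)) , least
    where
    least : ∀ p → IsUB unravelling p (node (left n _ _ _)) (node (right n _ _ _)) →
            node n ⊑ p
    least (node _)     (node⊑node p , node⊑node q) = node⊑node (children-≼⇒≼ p q)
    least (cap _ _ _)  (node⊑capˡ p , node⊑capˡ q) = node⊑capˡ (children-≼⇒≼ p q)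
    least (cap _ _ _)  (node⊑capʳ p , node⊑capʳ q) = node⊑capʳ (children-≼⇒≼ p q)
    least (cap _ _ _)  (node⊑capˡ (left-≼ p) , node⊑capʳ _)           = node⊑capˡ p
    least (cap _ _ _)  (node⊑capˡ ≼-refl     , node⊑capʳ (right-≼ q)) = node⊑capʳ q
    least (cap _ _ ns) (node⊑capˡ ≼-refl     , node⊑capʳ ≼-refl)      = ⊥-elim (ns left-right)
    least (cap _ _ _)  (node⊑capʳ (left-≼ p) , node⊑capˡ _)           = node⊑capʳ p
    least (cap _ _ _)  (node⊑capʳ ≼-refl     , node⊑capˡ (right-≼ q)) = node⊑capˡ q
    least (cap _ _ ns) (node⊑capʳ ≼-refl     , node⊑capˡ ≼-refl)      = ⊥-elim (ns right-left)

  node-sup⇒IsMub : ∀ {s s₁ s₂} {n : Node s} {a₁ : Node s₁} {a₂ : Node s₂} →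
                   IsSup unravelling (node n) (node a₁) (node a₂) → IsMub F s s₁ s₂
  node-sup⇒IsMub {s} {s₁} {s₂} {n} {a₁} {a₂}
                 sup@((node⊑node a₁≼n , node⊑node a₂≼n) , least) =
    IsMub-stable F ub (¬¬-map by-siblinghood ¬¬-excluded-middle)
    where
    ub : IsUB F s s₁ s₂
    ub = ≼⇒≤ a₁≼n , ≼⇒≤ a₂≼n

    parent-label : ∀ {s′ t u m} {parent : Node s′} →
                   IsSup unravelling (node n)
                         (node (left parent t u m)) (node (right parent t u m)) →
                   s ≡ s′
    parent-label {parent = parent} sup′ =
      cong proj₁ (node-injective (IsSup-unique unravelling sup′ (children-sup parent)))

    is-member : ∀ {ns} → node n ⊑ cap a₁ a₂ ns → s ≡ s₁ ⊎ s ≡ s₂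
    is-member (node⊑capˡ n≼a₁) = inj₁ (cong proj₁ (≼-antisym n≼a₁ a₁≼n))
    is-member (node⊑capʳ n≼a₂) = inj₂ (cong proj₁ (≼-antisym n≼a₂ a₂≼n))

    by-siblinghood : Dec (Siblings a₁ a₂) → IsMub F s s₁ s₂
    by-siblinghood (yes (left-right {m = m})) =
      subst (λ x → IsMub F x s₁ s₂) (sym (parent-label sup)) m
    by-siblinghood (yes (right-left {m = m})) =
      subst (λ x → IsMub F x s₁ s₂) (sym (parent-label (IsSup-sym unravelling sup)))
            (IsMub-sym F m)
    by-siblinghood (no ns) =
      IsUB-member⇒IsMub F ub
        (is-member (least (cap a₁ a₂ ns) (node⊑capˡ ≼-refl , node⊑capʳ ≼-refl)))

  module _ (V : Valuation F) where
    lift : Valuation unravelling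
    lift p (node {s} _) = V p s
    lift p (cap _ _ _)  = ⊥

    _⊩S_ : Point → Form → Set
    p ⊩S φ = forcesS unravelling lift p φ

    _⊩M_ : A → Form → Set
    s ⊩M φ = forcesM F V s φ

    transfer : ∀ φ {s} (n : Node s) → node n ⊩S φ ⇔ s ⊩M φ
    transfer bot       n = ⇔-id ⊥
    transfer (var p)   n = ⇔-id _
    transfer (neg φ)   n = ¬-cong-⇔ (transfer φ n)
    transfer (or φ ψ)  n = ¬-cong-⇔ (¬-cong-⇔ (transfer φ n) ×-⇔ ¬-cong-⇔ (transfer ψ n))
    transfer (dia φ ψ) {s} n =
      ¬-cong-⇔ (¬-cong-⇔ (mk⇔ sup-witness⇒mub-witness mub-witness⇒sup-witness))
      where
      SupWitness MubWitness : Set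
      SupWitness = ∃[ p ] ∃[ q ] (p ⊩S φ × q ⊩S ψ × IsSup unravelling (node n) p q)
      MubWitness = ∃[ t ] ∃[ u ] (t ⊩M φ × u ⊩M ψ × IsMub F s t u)

      sup-witness⇒mub-witness : SupWitness → MubWitness
      sup-witness⇒mub-witness (node {t} a , node {u} b , fa , fb , sup) =
        t , u , to (transfer φ a) fa , to (transfer ψ b) fb , node-sup⇒IsMub sup
      sup-witness⇒mub-witness (cap _ _ _ , _ , _ , _ , ((() , _) , _))
      sup-witness⇒mub-witness (node _ , cap _ _ _ , _ , _ , ((_ , ()) , _))

      mub-witness⇒sup-witness : MubWitness → SupWitness
      mub-witness⇒sup-witness (t , u , ft , fu , m) =
        node (left n t u m) , node (right n t u m) ,
        from (transfer φ _) ft , from (transfer ψ _) fu , children-sup n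

theorem2 : (φ : Form) → InMIL φ → InMIN φ
theorem2 φ valid F V s = to (transfer V φ (root s)) (valid unravelling (lift V) (node (root s)))
  where open Unravelling F
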